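{- Let $F$ be a $\{0,1\}$-matrix with $n$ rows. Then $X(F)\le n$.
   Context: A $\{0,1\}$-matrix $F$ is a subconfiguration of a $\{0,1\}$-matrix $A$, written $F \prec A$, if some matrix obtained from $F$ by permuting its rows and permuting its columns is a submatrix of $A$ (column multiplicities count: a column occurring $t$ times in $F$ must be matched to $t$ distinct columns of $A$). For $\{0,1\}$-matrices $A$ and $B$, the product $A\times B$ is the matrix whose columns are all columns obtained by placing a column of $A$ on top of a column of $B$, over all pairs of columns. For $r\ge1$: $\mathcal{I}_r$ is the $r\times r$ identity matrix, $\mathcal{I}_r^c$ its $\{0,1\}$-complement, and $\mathcal{T}_r$ the $r\times(r+1)$ matrix whose $j$-th column ($j=0,\dots,r$) has ones exactly in its first $j$ rows. For nonnegative integers $a,b,c$, $P_r(a,b,c)$ is the product of $a$ copies of $\mathcal{I}_r$, $b$ copies of $\mathcal{I}_r^c$ and $c$ copies of $\mathcal{T}_r$. $X(F)$ is the largest integer $N$ such that there exist nonnegative integers $a,b,c$ with $a+b+c=N$ and $F\not\prec P_r(a,b,c)$ for all $r\in\mathbb{N}$. -}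

module Defs where

open import Data.Bool using (Bool; true; false; not)
open import Data.Nat using (ℕ; zero; suc; _+_; _*_; _≤_)
open import Data.Fin using (Fin; toℕ; splitAt; remQuot)
open import Data.Fin.Properties using (_≟_)
import Data.Nat.Properties as ℕP
open import Data.Sum using (inj₁; inj₂)
open import Data.Product using (Σ; _×_; _,_; proj₁; proj₂)
open import Relation.Nullary.Decidable using (⌊_⌋)
open import Relation.Nullary using (¬_)
open import Relation.Binary.PropositionalEquality using (_≡_)
open import Function.Definitions using (Injective)

record Matrix : Set where
  constructor mat
  field
    rows  : ℕ
    cols  : ℕ
    entry : Fin rows → Fin cols → Bool
open Matrix public

-- F ≺ A : after permuting rows and columns of F, it is a submatrix of A,
-- i.e. there are injective maps on rows and columns preserving entries.
_≺_ : Matrix → Matrix → Set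
F ≺ A =
  Σ (Fin (rows F) → Fin (rows A)) λ σ →
  Σ (Fin (cols F) → Fin (cols A)) λ τ →
    Injective _≡_ _≡_ σ × Injective _≡_ _≡_ τ ×
    (∀ i j → entry F i j ≡ entry A (σ i) (τ j))

-- Product A × B: columns are all stackings of a column of A on a column of B.
_⊗_ : Matrix → Matrix → Matrix
A ⊗ B = mat (rows A + rows B) (cols A * cols B) e
  where
  e : Fin (rows A + rows B) → Fin (cols A * cols B) → Bool
  e i j with splitAt (rows A) i
  ... | inj₁ i₁ = entry A i₁ (proj₁ (remQuot {cols A} (cols B) j))
  ... | inj₂ i₂ = entry B i₂ (proj₂ (remQuot {cols A} (cols B) j))

-- Empty product: 0 rows, one (empty) column.
unitM : Matrix
unitM = mat 0 1 (λ ())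

_^⊗_ : Matrix → ℕ → Matrix
A ^⊗ zero  = unitM
A ^⊗ suc k = A ⊗ (A ^⊗ k)

Iₘ : ℕ → Matrix
Iₘ r = mat r r (λ i j → ⌊ i ≟ j ⌋)

Iᶜ : ℕ → Matrix
Iᶜ r = mat r r (λ i j → not ⌊ i ≟ j ⌋)

Tₘ : ℕ → Matrix
Tₘ r = mat r (suc r) (λ i j → ⌊ suc (toℕ i) ℕP.≤? toℕ j ⌋)

P : ℕ → ℕ → ℕ → ℕ → Matrix
P r a b c = (Iₘ r ^⊗ a) ⊗ ((Iᶜ r ^⊗ b) ⊗ (Tₘ r ^⊗ c))

Avoids : Matrix → ℕ → ℕ → ℕ → Set
Avoids F a b c = ∀ r → 1 ≤ r → ¬ (F ≺ P r a b c)

-- Suppose a + b + c > n and put m = cols F, r = m + 2.  In each of I_r, I_r^c and T_r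
-- the first row contains both a 0 and a 1, and there are at least m columns.  Give
-- each of the n rows of F its own factor of P_r(a,b,c), realised by the first row of
-- that factor, with a column chosen for every column of F carrying the right bit.
-- Some factor is left without rows; choosing m distinct columns there makes the m
-- columns of the product distinct, so F ≺ P_r(a,b,c).
module Submission where

open import Defs
open import Data.Bool using (Bool; true; false)
open import Data.Nat using (ℕ; zero; suc; _+_; _*_; _∸_; _≤_; _<_; z≤n; s≤s)
open import Data.Nat.Properties
  using (≤-total; _<?_; ≤-refl; ≮⇒≥; +-identityʳ; +-assoc; m+[n∸m]≡n; m+n∸m≡n;
         m≤n+o⇒m∸n≤o; ∸-monoˡ-<; m≤n+m; m≤n⇒m≤1+n)
open import Data.Fin using (Fin; zero; suc; _↑ˡ_; _↑ʳ_; splitAt; join; combine; inject≤)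
open import Data.Fin.Properties
  using (splitAt-↑ˡ; splitAt-↑ʳ; splitAt-join; join-splitAt; remQuot-combine;
         combine-injectiveˡ; combine-injectiveʳ; inject≤-injective)
open import Data.Sum as Sum using (_⊎_; inj₁; inj₂; [_,_]′)
open import Data.Sum.Function.Setoid using (⊎-injective)
open import Data.Sum.Relation.Binary.Pointwise using (Pointwise-≡⇒≡; ≡⇒Pointwise-≡)
open import Data.Product using (Σ; ∃; _×_; _,_; proj₁; proj₂)
open import Function using (_∘_)
open import Function.Definitions using (Injective)
open import Relation.Nullary using (yes; no)
open import Relation.Binary.PropositionalEquality
  using (_≡_; refl; sym; trans; cong; subst; module ≡-Reasoning)

-- F ≺ A without injectivity of the column map: one column of A may serve several columns of g.
record Embedding {k m : ℕ} (g : Fin k → Fin m → Bool) (A : Matrix) : Set where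
  field
    rowMap           : Fin k → Fin (rows A)
    colMap           : Fin m → Fin (cols A)
    rowMap-injective : Injective _≡_ _≡_ rowMap
    entries          : ∀ i j → g i j ≡ entry A (rowMap i) (colMap j)

open Embedding

ColumnInjective : ∀ {k m} {g : Fin k → Fin m → Bool} {A : Matrix} → Embedding g A → Set
ColumnInjective E = Injective _≡_ _≡_ (colMap E)

Universal : ℕ → ℕ → Matrix → Set
Universal k m A = (g : Fin k → Fin m → Bool) → Embedding g A

Universal≺ : ℕ → ℕ → Matrix → Set
Universal≺ k m A = (g : Fin k → Fin m → Bool) → Σ (Embedding g A) ColumnInjective

-- The gap between k ≤ x and k < x is a spare factor without rows, which separates the columns.
Capacity : ℕ → ℕ → Matrix → Set
Capacity m x A = (∀ {k} → k ≤ x → Universal k m A) × (∀ {k} → k < x → Universal≺ k m A)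

⊗-entry : ∀ (A B : Matrix) s (u : Fin (cols A)) (v : Fin (cols B)) →
          entry (A ⊗ B) (join (rows A) (rows B) s) (combine u v)
            ≡ [ (λ x → entry A x u) , (λ y → entry B y v) ]′ s
⊗-entry A B (inj₁ x) u v rewrite splitAt-↑ˡ (rows A) x (rows B) =
  cong (entry A x ∘ proj₁) (remQuot-combine u v)
⊗-entry A B (inj₂ y) u v rewrite splitAt-↑ʳ (rows A) (rows B) y =
  cong (entry B y ∘ proj₂) (remQuot-combine u v)

module ⊗-Embedding {k l m : ℕ} {A B : Matrix} (g : Fin (k + l) → Fin m → Bool)
                   (E₁ : Embedding (g ∘ (_↑ˡ l)) A) (E₂ : Embedding (g ∘ (k ↑ʳ_)) B) where

  rowMap⊎ : Fin k ⊎ Fin l → Fin (rows A) ⊎ Fin (rows B)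
  rowMap⊎ = Sum.map (rowMap E₁) (rowMap E₂)

  rowMap⊎-injective : Injective _≡_ _≡_ rowMap⊎
  rowMap⊎-injective =
    Pointwise-≡⇒≡ ∘ ⊎-injective (rowMap-injective E₁) (rowMap-injective E₂) ∘ ≡⇒Pointwise-≡

  rowMap⊗ : Fin (k + l) → Fin (rows A + rows B)
  rowMap⊗ = join (rows A) (rows B) ∘ rowMap⊎ ∘ splitAt k

  colMap⊗ : Fin m → Fin (cols A * cols B)
  colMap⊗ j = combine (colMap E₁ j) (colMap E₂ j)

  rowMap⊗-injective : Injective _≡_ _≡_ rowMap⊗
  rowMap⊗-injective {i} {i′} eq = begin
    i                        ≡⟨ sym (join-splitAt k l i) ⟩
    join k l (splitAt k i)   ≡⟨ cong (join k l) (rowMap⊎-injective {splitAt k i} {splitAt k i′} split-eq) ⟩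
    join k l (splitAt k i′)  ≡⟨ join-splitAt k l i′ ⟩
    i′                       ∎
    where
    open ≡-Reasoning

    split-eq : rowMap⊎ (splitAt k i) ≡ rowMap⊎ (splitAt k i′)
    split-eq = begin
      rowMap⊎ (splitAt k i)          ≡⟨ sym (splitAt-join (rows A) (rows B) _) ⟩
      splitAt (rows A) (rowMap⊗ i)   ≡⟨ cong (splitAt (rows A)) eq ⟩
      splitAt (rows A) (rowMap⊗ i′)  ≡⟨ splitAt-join (rows A) (rows B) _ ⟩
      rowMap⊎ (splitAt k i′)         ∎

  entries-join : ∀ s j →
                 g (join k l s) j ≡ entry (A ⊗ B) (join (rows A) (rows B) (rowMap⊎ s)) (colMap⊗ j)
  entries-join (inj₁ x) j = trans (entries E₁ x j) (sym (⊗-entry A B (inj₁ (rowMap E₁ x)) _ _))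
  entries-join (inj₂ y) j = trans (entries E₂ y j) (sym (⊗-entry A B (inj₂ (rowMap E₂ y)) _ _))

  embedding : Embedding g (A ⊗ B)
  embedding = record
    { rowMap           = rowMap⊗
    ; colMap           = colMap⊗
    ; rowMap-injective = rowMap⊗-injective
    ; entries          = λ i j → subst (λ i′ → g i′ j ≡ entry (A ⊗ B) (rowMap⊗ i) (colMap⊗ j))
                                       (join-splitAt k l i) (entries-join (splitAt k i) j)
    }

  colMap-injectiveˡ : ColumnInjective E₁ → ColumnInjective embedding
  colMap-injectiveˡ inj {j} {j′} eq =
    inj (combine-injectiveˡ (colMap E₁ j) (colMap E₂ j) (colMap E₁ j′) (colMap E₂ j′) eq)

  colMap-injectiveʳ : ColumnInjective E₂ → ColumnInjective embedding
  colMap-injectiveʳ inj {j} {j′} eq =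
    inj (combine-injectiveʳ (colMap E₁ j) (colMap E₂ j) (colMap E₁ j′) (colMap E₂ j′) eq)

module _ {k l m : ℕ} {A B : Matrix} where

  Universal-⊗ : Universal k m A → Universal l m B → Universal (k + l) m (A ⊗ B)
  Universal-⊗ U₁ U₂ g = ⊗-Embedding.embedding g (U₁ _) (U₂ _)

  Universal≺-⊗ˡ : Universal≺ k m A → Universal l m B → Universal≺ (k + l) m (A ⊗ B)
  Universal≺-⊗ˡ U₁ U₂ g =
    ⊗-Embedding.embedding g E₁ (U₂ _) , ⊗-Embedding.colMap-injectiveˡ g E₁ (U₂ _) inj
    where open Σ (U₁ (g ∘ (_↑ˡ l))) renaming (proj₁ to E₁; proj₂ to inj)

  Universal≺-⊗ʳ : Universal k m A → Universal≺ l m B → Universal≺ (k + l) m (A ⊗ B)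
  Universal≺-⊗ʳ U₁ U₂ g =
    ⊗-Embedding.embedding g (U₁ _) E₂ , ⊗-Embedding.colMap-injectiveʳ g (U₁ _) E₂ inj
    where open Σ (U₂ (g ∘ (k ↑ʳ_))) renaming (proj₁ to E₂; proj₂ to inj)

capacity-unitM : ∀ {m} → Capacity m 0 unitM
capacity-unitM = (λ { z≤n g → record { rowMap = λ () ; colMap = λ _ → zero
                                     ; rowMap-injective = λ {} ; entries = λ () } })
               , λ ()

capacity-⊗ : ∀ {m x y A B} → Capacity m x A → Capacity m y B → Capacity m (x + y) (A ⊗ B)
capacity-⊗ {m} {x} {y} {A} {B} (U₁ , U≺₁) (U₂ , U≺₂) = U , U≺
  where
  U : ∀ {k} → k ≤ x + y → Universal k m (A ⊗ B)
  U {k} k≤x+y with ≤-total k x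
  ... | inj₁ k≤x = subst (λ k → Universal k m (A ⊗ B)) (+-identityʳ k)
                         (Universal-⊗ (U₁ k≤x) (U₂ z≤n))
  ... | inj₂ x≤k = subst (λ k → Universal k m (A ⊗ B)) (m+[n∸m]≡n x≤k)
                         (Universal-⊗ (U₁ ≤-refl) (U₂ (m≤n+o⇒m∸n≤o k x k≤x+y)))

  U≺ : ∀ {k} → k < x + y → Universal≺ k m (A ⊗ B)
  U≺ {k} k<x+y with k <? x
  ... | yes k<x = subst (λ k → Universal≺ k m (A ⊗ B)) (+-identityʳ k)
                        (Universal≺-⊗ˡ (U≺₁ k<x) (U₂ z≤n))
  ... | no k≮x  = subst (λ k → Universal≺ k m (A ⊗ B)) (m+[n∸m]≡n (≮⇒≥ k≮x))
                        (Universal≺-⊗ʳ (U₁ ≤-refl) (U≺₂ k∸x<y))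
    where
    k∸x<y : k ∸ x < y
    k∸x<y = subst (k ∸ x <_) (m+n∸m≡n x y) (∸-monoˡ-< k<x+y (≮⇒≥ k≮x))

capacity-^⊗ : ∀ {m A} → Capacity m 1 A → ∀ a → Capacity m a (A ^⊗ a)
capacity-^⊗ c zero    = capacity-unitM
capacity-^⊗ c (suc a) = capacity-⊗ c (capacity-^⊗ c a)

MixedRow : (A : Matrix) → Fin (rows A) → Set
MixedRow A z = ∀ b → ∃ λ j → entry A z j ≡ b

capacity-one : ∀ {m A} (z : Fin (rows A)) → MixedRow A z → m ≤ cols A → Capacity m 1 A
capacity-one {m} {A} z mixed m≤cols = U , U≺
  where
  noRows : Universal≺ 0 m A
  noRows g = record { rowMap = λ () ; colMap = λ j → inject≤ j m≤cols
                    ; rowMap-injective = λ {} ; entries = λ () }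
           , λ {j} {j′} → inject≤-injective m≤cols m≤cols j j′

  oneRow : Universal 1 m A
  oneRow g = record { rowMap = λ _ → z ; colMap = λ j → proj₁ (mixed (g zero j))
                    ; rowMap-injective = λ { {zero} {zero} _ → refl }
                    ; entries = λ { zero j → sym (proj₂ (mixed (g zero j))) } }

  U : ∀ {k} → k ≤ 1 → Universal k m A
  U {zero}        _ = proj₁ ∘ noRows
  U {suc zero}    _ = oneRow
  U {suc (suc _)} (s≤s ())

  U≺ : ∀ {k} → k < 1 → Universal≺ k m A
  U≺ {zero}  _ = noRows
  U≺ {suc _} (s≤s ())

Iₘ-mixedRow : ∀ r → MixedRow (Iₘ (2 + r)) zero
Iₘ-mixedRow r true  = zero , refl
Iₘ-mixedRow r false = suc zero , refl

Iᶜ-mixedRow : ∀ r → MixedRow (Iᶜ (2 + r)) zero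
Iᶜ-mixedRow r true  = suc zero , refl
Iᶜ-mixedRow r false = zero , refl

Tₘ-mixedRow : ∀ r → MixedRow (Tₘ (1 + r)) zero
Tₘ-mixedRow r true  = suc zero , refl
Tₘ-mixedRow r false = zero , refl

capacity-P : ∀ {m} r a b c → m ≤ 2 + r → Capacity m (a + (b + c)) (P (2 + r) a b c)
capacity-P r a b c m≤2+r =
  capacity-⊗ (capacity-^⊗ (capacity-one zero (Iₘ-mixedRow r) m≤2+r) a)
    (capacity-⊗ (capacity-^⊗ (capacity-one zero (Iᶜ-mixedRow r) m≤2+r) b)
                (capacity-^⊗ (capacity-one zero (Tₘ-mixedRow (suc r)) (m≤n⇒m≤1+n m≤2+r)) c))

mainTheorem2 : (F : Matrix) (a b c : ℕ) → Avoids F a b c →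
               a + b + c ≤ rows F
mainTheorem2 F a b c avoids =
  ≮⇒≥ λ n<N → avoids (2 + cols F) (s≤s z≤n) (F≺P (subst (rows F <_) (+-assoc a b c) n<N))
  where
  F≺P : rows F < a + (b + c) → F ≺ P (2 + cols F) a b c
  F≺P n<N with proj₂ (capacity-P (cols F) a b c (m≤n+m (cols F) 2)) n<N (entry F)
  ... | E , colMap-injective = rowMap E , colMap E , rowMap-injective E , colMap-injective , entries E
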